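{- Let $(G,\phi)$ be a $C_2$-tight graph containing a vertex $v$ such that $v$ is incident to exactly two elements of $E\cup L$ (that is, either exactly two edges and no loop, or exactly one edge and exactly one loop). Then the graph obtained from $G$ by deleting $v$ and $v'$ together with all their incident edges and loops, with the induced $\mathbb{Z}/2\mathbb{Z}$-action, is $C_2$-tight.
   Context: A looped simple graph $G=(V,E,L)$: finite vertex set, edges unordered pairs of distinct vertices (no multiple edges), loops each incident to one vertex (possibly several per vertex). $G$ is sparse if $|E'|+|L'|\le2|V'|$ for every subgraph $(V',E',L')$ and $|E'|\le2|V'|-3$ for every loopless subgraph with $E'\ne\emptyset$; tight if sparse and $|E|+|L|=2|V|$. $\Gamma=\mathbb{Z}/2\mathbb{Z}$ and $(G,\phi)$ is $\Gamma$-symmetric, i.e. $\phi:\Gamma\to\mathrm{Aut}(G)$ is a homomorphism (automorphisms = permutations of $V$ and of $L$ preserving adjacency and incidence); for a vertex $u$, $u'$ denotes its image under the non-trivial element. The non-trivial element fixes a vertex $u$ if $u'=u$, an edge if it fixes or swaps its endpoints, a loop if it maps it to itself. $(G,\phi)$ is $C_2$-tight if $G$ is tight and either no vertex, edge or loop is fixed, or exactly one vertex and exactly two loops and no edge are fixed. -}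

module Defs where

open import Data.Nat using (ℕ; _+_; _*_; _≤_)
open import Data.Fin using (Fin)
open import Data.Fin.Properties using (_≟_)
open import Data.Fin.Subset using (Subset; _∈_; ∣_∣)
open import Data.List using (List; length; filter; allFin)
open import Data.Product using (Σ; ∃; _×_; _,_)
open import Data.Sum using (_⊎_)
open import Relation.Nullary using (¬_)
open import Relation.Nullary.Decidable using (_⊎-dec_)
open import Relation.Binary.PropositionalEquality using (_≡_; _≢_)
open import Function.Bundles using (_⇔_)
open import Function.Definitions using (Injective)

-- Looped graphs: vertices Fin nV, edges Fin nE (each with two endpoints),
-- loops Fin nL (each incident to one vertex).

record Graph : Set where
  field
    nV nE nL : ℕ
    src tgt  : Fin nE → Fin nV
    at       : Fin nL → Fin nV
open Graph public

Joins : (G : Graph) → Fin (nE G) → Fin (nV G) → Fin (nV G) → Set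
Joins G e u w = (src G e ≡ u × tgt G e ≡ w) ⊎ (src G e ≡ w × tgt G e ≡ u)

record IsLoopedSimple (G : Graph) : Set where
  field
    noSelfEdge : ∀ e → src G e ≢ tgt G e
    noMultiEdge : ∀ e f → Joins G f (src G e) (tgt G e) → e ≡ f

Adjacent : (G : Graph) → Fin (nV G) → Fin (nV G) → Set
Adjacent G u w = ∃ λ e → Joins G e u w

-- Z/2-action: image of the non-trivial element, on vertices and on loops.

record Action (G : Graph) : Set where
  field
    σV : Fin (nV G) → Fin (nV G)
    σL : Fin (nL G) → Fin (nL G)
open Action public

-- φ : Z/2 → Aut(G) is a homomorphism: σ is an automorphism with σ∘σ = id.
record IsSymmetric (G : Graph) (a : Action G) : Set where
  field
    invV   : ∀ u → σV a (σV a u) ≡ u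
    invL   : ∀ l → σL a (σL a l) ≡ l
    adj    : ∀ u w → Adjacent G u w ⇔ Adjacent G (σV a u) (σV a w)
    incid  : ∀ l → at G (σL a l) ≡ σV a (at G l)

IsSubgraph : (G : Graph) → Subset (nV G) → Subset (nE G) → Subset (nL G) → Set
IsSubgraph G V' E' L' =
  (∀ e → e ∈ E' → src G e ∈ V' × tgt G e ∈ V') × (∀ l → l ∈ L' → at G l ∈ V')

Sparse : Graph → Set
Sparse G = ∀ V' E' L' → IsSubgraph G V' E' L' →
  (∣ E' ∣ + ∣ L' ∣ ≤ 2 * ∣ V' ∣)
  × (∣ L' ∣ ≡ 0 → 1 ≤ ∣ E' ∣ → ∣ E' ∣ + 3 ≤ 2 * ∣ V' ∣)

Tight : Graph → Set
Tight G = Sparse G × (nE G + nL G ≡ 2 * nV G)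

FixedV : (G : Graph) → Action G → Fin (nV G) → Set
FixedV G a u = σV a u ≡ u

FixedE : (G : Graph) → Action G → Fin (nE G) → Set
FixedE G a e = Joins G e (σV a (src G e)) (σV a (tgt G e))

FixedL : (G : Graph) → Action G → Fin (nL G) → Set
FixedL G a l = σL a l ≡ l

ExactlyOne : {n : ℕ} → (Fin n → Set) → Set
ExactlyOne P = ∃ λ x → P x × (∀ y → P y → y ≡ x)

ExactlyTwo : {n : ℕ} → (Fin n → Set) → Set
ExactlyTwo P = Σ _ λ x → Σ _ λ y → x ≢ y × P x × P y × (∀ z → P z → z ≡ x ⊎ z ≡ y)

C2Tight : (G : Graph) → Action G → Set
C2Tight G a = Tight G ×
  ( ((∀ u → ¬ FixedV G a u) × (∀ e → ¬ FixedE G a e) × (∀ l → ¬ FixedL G a l))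
  ⊎ (ExactlyOne (FixedV G a) × ExactlyTwo (FixedL G a) × (∀ e → ¬ FixedE G a e)))

incidentEdges : (G : Graph) → Fin (nV G) → List (Fin (nE G))
incidentEdges G v = filter (λ e → (src G e ≟ v) ⊎-dec (tgt G e ≟ v)) (allFin (nE G))

incidentLoops : (G : Graph) → Fin (nV G) → List (Fin (nL G))
incidentLoops G v = filter (λ l → at G l ≟ v) (allFin (nL G))

incidence : (G : Graph) → Fin (nV G) → ℕ
incidence G v = length (incidentEdges G v) + length (incidentLoops G v)

-- (H , b) is (an isomorphic copy of) the graph obtained from (G , a) by
-- deleting v and v' = σV a v with all incident edges and loops, with the
-- induced action: ιV, ιE, ιL are bijections onto the remaining vertices,
-- edges and loops, compatible with incidence and with the action.

record IsDeletion (G : Graph) (a : Action G) (v : Fin (nV G))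
                  (H : Graph) (b : Action H) : Set where
  field
    ιV : Fin (nV H) → Fin (nV G)
    ιE : Fin (nE H) → Fin (nE G)
    ιL : Fin (nL H) → Fin (nL G)
    ιV-inj : Injective _≡_ _≡_ ιV
    ιE-inj : Injective _≡_ _≡_ ιE
    ιL-inj : Injective _≡_ _≡_ ιL
    ιV-avoid : ∀ u → ιV u ≢ v × ιV u ≢ σV a v
    ιV-onto  : ∀ w → w ≢ v → w ≢ σV a v → ∃ λ u → ιV u ≡ w
    ιE-src : ∀ e → src G (ιE e) ≡ ιV (src H e)
    ιE-tgt : ∀ e → tgt G (ιE e) ≡ ιV (tgt H e)
    ιE-onto : ∀ f → src G f ≢ v → src G f ≢ σV a v
                  → tgt G f ≢ v → tgt G f ≢ σV a v → ∃ λ e → ιE e ≡ f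
    ιL-at : ∀ l → at G (ιL l) ≡ ιV (at H l)
    ιL-onto : ∀ m → at G m ≢ v → at G m ≢ σV a v → ∃ λ l → ιL l ≡ m
    ιV-equiv : ∀ u → ιV (σV b u) ≡ σV a (ιV u)
    ιL-equiv : ∀ l → ιL (σL b l) ≡ σL a (ιL l)

-- Every edge or loop of G missing from H is incident to v or v', and σ maps those at v'
-- injectively to those at v; so at most 2 + 2 elements of E ∪ L disappear together with
-- two vertices (at most 2 together with one vertex if v = v'), hence |E| + |L| ≥ 2|V|
-- survives, while sparsity passes to subgraphs.  A fixed loop sits at a fixed vertex, so
-- the fixed elements of G all survive when v ≠ v', and all vanish with v when v = v' is
-- the unique fixed vertex.

module Submission where

open import Level using (Level)
open import Data.Nat using (ℕ; zero; suc; _+_; _*_; _≤_; z≤n; s≤s)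
open import Data.Nat.Properties
  using (≤-trans; ≤-antisym; ≤-reflexive; +-suc; +-comm; +-mono-≤; +-monoʳ-≤;
         +-cancelˡ-≤; *-distribˡ-+; *-monoʳ-≤; +-commutativeSemigroup; module ≤-Reasoning)
open import Algebra.Properties.CommutativeSemigroup +-commutativeSemigroup using (interchange)
open import Data.Bool using (true; false)
open import Data.Fin using (Fin; zero; suc)
open import Data.Fin.Properties using (_≟_; any?; suc-injective; 0≢1+n)
open import Data.Fin.Subset using (Subset; _∈_; ∣_∣; _∪_; _-_; inside; outside; ⊤)
open import Data.Fin.Subset.Properties
  using (_∈?_; ∈⊤; ∣⊤∣≡n; ∣p∣≤∣x∷p∣; p⊆q⇒∣p∣≤∣q∣; x∈p∪q⁺; ∪-idem; x∈p∧x≢y⇒x∈p-y; x∈p⇒∣p-x∣<∣p∣)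
open import Data.List using (length; filter; allFin)
import Data.List as List
open import Data.Vec using (_∷_; []; here; there)
import Data.Vec as Vec
open import Data.Product using (∃; _×_; _,_; proj₁; proj₂; uncurry)
open import Data.Sum using (_⊎_; inj₁; inj₂)
import Data.Sum as Sum
open import Function using (_∘_; id)
open import Function.Bundles using (_⇔_; mk⇔; Equivalence)
open import Function.Definitions using (Injective)
open import Relation.Nullary using (¬_; yes; no; does; contradiction)
open import Relation.Nullary.Decidable using (_×-dec_; _⊎-dec_)
open import Relation.Unary using (Pred; Decidable)
open import Relation.Binary.PropositionalEquality

open import Defs

private
  variable
    ℓ : Level
    m n : ℕ

∣p∪q∣≤∣p∣+∣q∣ : (p q : Subset n) → ∣ p ∪ q ∣ ≤ ∣ p ∣ + ∣ q ∣
∣p∪q∣≤∣p∣+∣q∣ [] [] = z≤n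
∣p∪q∣≤∣p∣+∣q∣ (inside ∷ p) (t ∷ q) = s≤s (≤-trans (∣p∪q∣≤∣p∣+∣q∣ p q) (+-monoʳ-≤ ∣ p ∣ (∣p∣≤∣x∷p∣ t q)))
∣p∪q∣≤∣p∣+∣q∣ (outside ∷ p) (inside ∷ q) rewrite +-suc ∣ p ∣ ∣ q ∣ = s≤s (∣p∪q∣≤∣p∣+∣q∣ p q)
∣p∪q∣≤∣p∣+∣q∣ (outside ∷ p) (outside ∷ q) = ∣p∪q∣≤∣p∣+∣q∣ p q

injection⇒∣p∣≤∣q∣ : {p : Subset m} {q : Subset n}
  (f : ∀ {x} → x ∈ p → Fin n) → (∀ {x} (x∈p : x ∈ p) → f x∈p ∈ q)
  → (∀ {x y} (x∈p : x ∈ p) (y∈p : y ∈ p) → f x∈p ≡ f y∈p → x ≡ y)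
  → ∣ p ∣ ≤ ∣ q ∣
injection⇒∣p∣≤∣q∣ {p = []} f f∈q f-inj = z≤n
injection⇒∣p∣≤∣q∣ {p = outside ∷ p} f f∈q f-inj =
  injection⇒∣p∣≤∣q∣ (f ∘ there) (f∈q ∘ there) (λ x∈p y∈p → suc-injective ∘ f-inj (there x∈p) (there y∈p))
injection⇒∣p∣≤∣q∣ {p = inside ∷ p} {q = q} f f∈q f-inj =
  ≤-trans (s≤s rest) (x∈p⇒∣p-x∣<∣p∣ (f∈q here))
  where
  rest : ∣ p ∣ ≤ ∣ q - f here ∣
  rest = injection⇒∣p∣≤∣q∣ (f ∘ there)
    (λ x∈p → x∈p∧x≢y⇒x∈p-y (f∈q (there x∈p)) (λ eq → 0≢1+n (sym (f-inj (there x∈p) here eq))))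
    (λ x∈p y∈p → suc-injective ∘ f-inj (there x∈p) (there y∈p))

fromDec : {P : Pred (Fin n) ℓ} → Decidable P → Subset n
fromDec P? = Vec.tabulate (does ∘ P?)

∈-fromDec⁺ : {P : Pred (Fin n) ℓ} (P? : Decidable P) {x : Fin n} → P x → x ∈ fromDec P?
∈-fromDec⁺ P? {zero} px with P? zero
... | yes _ = here
... | no ¬px = contradiction px ¬px
∈-fromDec⁺ P? {suc x} px = there (∈-fromDec⁺ (P? ∘ suc) px)

∈-fromDec⁻ : {P : Pred (Fin n) ℓ} (P? : Decidable P) {x : Fin n} → x ∈ fromDec P? → P x
∈-fromDec⁻ P? {zero} x∈p with P? zero | x∈p
... | yes px | _ = px
∈-fromDec⁻ P? {suc x} (there x∈p) = ∈-fromDec⁻ (P? ∘ suc) x∈p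

length-filter-tabulate : {A : Set} {P : Pred A ℓ} (P? : Decidable P) (g : Fin n → A)
  → length (filter P? (List.tabulate g)) ≡ ∣ fromDec (P? ∘ g) ∣
length-filter-tabulate {n = zero} P? g = refl
length-filter-tabulate {n = suc n} P? g with does (P? (g zero))
... | true = cong suc (length-filter-tabulate P? (g ∘ suc))
... | false = length-filter-tabulate P? (g ∘ suc)

length-filter-allFin : {P : Pred (Fin n) ℓ} (P? : Decidable P) → length (filter P? (allFin n)) ≡ ∣ fromDec P? ∣
length-filter-allFin P? = length-filter-tabulate P? id

preimage? : (f : Fin m → Fin n) (p : Subset m) → Decidable (λ y → ∃ λ x → x ∈ p × f x ≡ y)
preimage? f p y = any? (λ x → (x ∈? p) ×-dec (f x ≟ y))

image : (Fin m → Fin n) → Subset m → Subset n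
image f p = fromDec (preimage? f p)

∈-image⁺ : (f : Fin m → Fin n) {p : Subset m} {x : Fin m} → x ∈ p → f x ∈ image f p
∈-image⁺ f x∈p = ∈-fromDec⁺ (preimage? f _) (_ , x∈p , refl)

∈-image⁻ : (f : Fin m → Fin n) {p : Subset m} {y : Fin n} → y ∈ image f p → ∃ λ x → x ∈ p × f x ≡ y
∈-image⁻ f = ∈-fromDec⁻ (preimage? f _)

∣image∣≡∣p∣ : {f : Fin m → Fin n} → Injective _≡_ _≡_ f → (p : Subset m) → ∣ image f p ∣ ≡ ∣ p ∣
∣image∣≡∣p∣ {f = f} f-inj p = ≤-antisym
  (injection⇒∣p∣≤∣q∣ (proj₁ ∘ ∈-image⁻ f) (proj₁ ∘ proj₂ ∘ ∈-image⁻ f)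
    (λ y∈ z∈ eq → trans (sym (proj₂ (proj₂ (∈-image⁻ f y∈)))) (trans (cong f eq) (proj₂ (proj₂ (∈-image⁻ f z∈))))))
  (injection⇒∣p∣≤∣q∣ (λ {x} _ → f x) (∈-image⁺ f) (λ _ _ → f-inj))

ExactlyOne-pullback : {P : Fin n → Set} {Q : Fin m → Set} {f : Fin m → Fin n}
  → Injective _≡_ _≡_ f → (∀ x → Q x ⇔ P (f x)) → (∀ {y} → P y → ∃ λ x → f x ≡ y)
  → ExactlyOne P → ExactlyOne Q
ExactlyOne-pullback f-inj Q⇔P onto (y , Py , only) with onto Py
... | x , refl = x , Q⇔P x .Equivalence.from Py , λ z Qz → f-inj (only _ (Q⇔P z .Equivalence.to Qz))

ExactlyTwo-pullback : {P : Fin n → Set} {Q : Fin m → Set} {f : Fin m → Fin n}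
  → Injective _≡_ _≡_ f → (∀ x → Q x ⇔ P (f x)) → (∀ {y} → P y → ∃ λ x → f x ≡ y)
  → ExactlyTwo P → ExactlyTwo Q
ExactlyTwo-pullback {f = f} f-inj Q⇔P onto (y , z , y≢z , Py , Pz , only) with onto Py | onto Pz
... | x , refl | w , refl =
  x , w , y≢z ∘ cong f , Q⇔P x .Equivalence.from Py , Q⇔P w .Equivalence.from Pz
    , λ t Qt → Sum.map f-inj f-inj (only _ (Q⇔P t .Equivalence.to Qt))

incidentEdge? : (G : Graph) (x : Fin (nV G)) → Decidable (λ e → src G e ≡ x ⊎ tgt G e ≡ x)
incidentEdge? G x e = (src G e ≟ x) ⊎-dec (tgt G e ≟ x)

incidentLoop? : (G : Graph) (x : Fin (nV G)) → Decidable (λ l → at G l ≡ x)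
incidentLoop? G x l = at G l ≟ x

edgesAt : (G : Graph) → Fin (nV G) → Subset (nE G)
edgesAt G x = fromDec (incidentEdge? G x)

loopsAt : (G : Graph) → Fin (nV G) → Subset (nL G)
loopsAt G x = fromDec (incidentLoop? G x)

incidence≡∣edgesAt∣+∣loopsAt∣ : (G : Graph) (x : Fin (nV G))
  → incidence G x ≡ ∣ edgesAt G x ∣ + ∣ loopsAt G x ∣
incidence≡∣edgesAt∣+∣loopsAt∣ G x = cong₂ _+_
  (length-filter-allFin (incidentEdge? G x)) (length-filter-allFin (incidentLoop? G x))

module JoinsProperties (G : Graph) where

  Joins-sym : ∀ {e x y} → Joins G e x y → Joins G e y x
  Joins-sym (inj₁ st) = inj₂ st
  Joins-sym (inj₂ st) = inj₁ st

  Joins⇒∈edgesAt : ∀ {e x y} → Joins G e x y → e ∈ edgesAt G x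
  Joins⇒∈edgesAt (inj₁ (s , _)) = ∈-fromDec⁺ (incidentEdge? G _) (inj₁ s)
  Joins⇒∈edgesAt (inj₂ (_ , t)) = ∈-fromDec⁺ (incidentEdge? G _) (inj₂ t)

  ∈edgesAt⇒Joins : ∀ {e x} → e ∈ edgesAt G x → ∃ λ y → Joins G e x y
  ∈edgesAt⇒Joins {e} e∈ with ∈-fromDec⁻ (incidentEdge? G _) e∈
  ... | inj₁ s = tgt G e , inj₁ (s , refl)
  ... | inj₂ t = src G e , inj₂ (refl , t)

  Joins-other-unique : ∀ {e x y z} → Joins G e x y → Joins G e x z → y ≡ z
  Joins-other-unique (inj₁ (s , t)) (inj₁ (s' , t')) = trans (sym t) t'
  Joins-other-unique (inj₁ (s , t)) (inj₂ (s' , t')) = trans (sym t) (trans t' (trans (sym s) s'))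
  Joins-other-unique (inj₂ (s , t)) (inj₁ (s' , t')) = trans (sym s) (trans s' (trans (sym t) t'))
  Joins-other-unique (inj₂ (s , t)) (inj₂ (s' , t')) = trans (sym s) s'

  Joins-unique : IsLoopedSimple G → ∀ {e f x y} → Joins G e x y → Joins G f x y → e ≡ f
  Joins-unique LS (inj₁ (refl , refl)) j = IsLoopedSimple.noMultiEdge LS _ _ j
  Joins-unique LS (inj₂ (refl , refl)) j = IsLoopedSimple.noMultiEdge LS _ _ (Joins-sym j)

module Symmetric {G : Graph} {a : Action G} (SY : IsSymmetric G a) where

  open IsSymmetric SY
  open JoinsProperties G

  σV-injective : Injective _≡_ _≡_ (σV a)
  σV-injective {x} {y} eq = trans (sym (invV x)) (trans (cong (σV a) eq) (invV y))

  σL-injective : Injective _≡_ _≡_ (σL a)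
  σL-injective {l} {m} eq = trans (sym (invL l)) (trans (cong (σL a) eq) (invL m))

  ∣edgesAt∣≤∣edgesAt-σV∣ : IsLoopedSimple G → ∀ x → ∣ edgesAt G x ∣ ≤ ∣ edgesAt G (σV a x) ∣
  ∣edgesAt∣≤∣edgesAt-σV∣ LS x =
    injection⇒∣p∣≤∣q∣ (proj₁ ∘ image-edge) (Joins⇒∈edgesAt ∘ proj₂ ∘ image-edge) image-edge-injective
    where
    other : ∀ {e} → e ∈ edgesAt G x → Fin (nV G)
    other = proj₁ ∘ ∈edgesAt⇒Joins

    image-edge : ∀ {e} (e∈ : e ∈ edgesAt G x) → ∃ λ f → Joins G f (σV a x) (σV a (other e∈))
    image-edge e∈ = adj x (other e∈) .Equivalence.to (_ , proj₂ (∈edgesAt⇒Joins e∈))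

    image-edge-injective : ∀ {e f} (e∈ : e ∈ edgesAt G x) (f∈ : f ∈ edgesAt G x)
      → proj₁ (image-edge e∈) ≡ proj₁ (image-edge f∈) → e ≡ f
    image-edge-injective e∈ f∈ eq = Joins-unique LS (proj₂ (∈edgesAt⇒Joins e∈))
      (subst (Joins G _ x) (sym same-other) (proj₂ (∈edgesAt⇒Joins f∈)))
      where
      same-other : other e∈ ≡ other f∈
      same-other = σV-injective (Joins-other-unique (proj₂ (image-edge e∈))
        (subst (λ g → Joins G g (σV a x) (σV a (other f∈))) (sym eq) (proj₂ (image-edge f∈))))

  ∣loopsAt∣≤∣loopsAt-σV∣ : ∀ x → ∣ loopsAt G x ∣ ≤ ∣ loopsAt G (σV a x) ∣
  ∣loopsAt∣≤∣loopsAt-σV∣ x = injection⇒∣p∣≤∣q∣ (λ {l} _ → σL a l)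
    (λ {l} l∈ → ∈-fromDec⁺ (incidentLoop? G _) (trans (incid l) (cong (σV a) (∈-fromDec⁻ (incidentLoop? G x) l∈))))
    (λ _ _ → σL-injective)

  incidence-σV : IsLoopedSimple G → ∀ x → incidence G x ≤ incidence G (σV a x)
  incidence-σV LS x = begin
    incidence G x                                  ≡⟨ incidence≡∣edgesAt∣+∣loopsAt∣ G x ⟩
    ∣ edgesAt G x ∣ + ∣ loopsAt G x ∣               ≤⟨ +-mono-≤ (∣edgesAt∣≤∣edgesAt-σV∣ LS x) (∣loopsAt∣≤∣loopsAt-σV∣ x) ⟩
    ∣ edgesAt G (σV a x) ∣ + ∣ loopsAt G (σV a x) ∣ ≡⟨ incidence≡∣edgesAt∣+∣loopsAt∣ G (σV a x) ⟨
    incidence G (σV a x)                           ∎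
    where open ≤-Reasoning

  fixed-loop⇒fixed-vertex : ∀ {l} → FixedL G a l → FixedV G a (at G l)
  fixed-loop⇒fixed-vertex {l} fixed = trans (sym (incid l)) (cong (at G) fixed)

  fixed-vertex-avoids-orbit : ∀ {w x} → FixedV G a w → ¬ FixedV G a x → w ≢ x × w ≢ σV a x
  fixed-vertex-avoids-orbit {w} {x} fixed moved =
      (λ { refl → moved fixed })
    , (λ { refl → moved (trans (sym fixed) (invV x)) })

Sparse⇒size≤ : (G : Graph) → Sparse G → nE G + nL G ≤ 2 * nV G
Sparse⇒size≤ G sparseG with sparseG ⊤ ⊤ ⊤ ((λ _ _ → ∈⊤ , ∈⊤) , λ _ _ → ∈⊤)
... | bound , _ rewrite ∣⊤∣≡n (nE G) | ∣⊤∣≡n (nL G) | ∣⊤∣≡n (nV G) = bound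

C2Fixed : (G : Graph) → Action G → Set
C2Fixed G a =
    ((∀ u → ¬ FixedV G a u) × (∀ e → ¬ FixedE G a e) × (∀ l → ¬ FixedL G a l))
  ⊎ (ExactlyOne (FixedV G a) × ExactlyTwo (FixedL G a) × (∀ e → ¬ FixedE G a e))

module Deletion {G : Graph} {a : Action G} {v : Fin (nV G)} {H : Graph} {b : Action H}
                (D : IsDeletion G a v H b) where

  open IsDeletion D

  Joins-ι : ∀ {e x y} → Joins H e x y → Joins G (ιE e) (ιV x) (ιV y)
  Joins-ι {e} (inj₁ (s , t)) = inj₁ (trans (ιE-src e) (cong ιV s) , trans (ιE-tgt e) (cong ιV t))
  Joins-ι {e} (inj₂ (s , t)) = inj₂ (trans (ιE-src e) (cong ιV s) , trans (ιE-tgt e) (cong ιV t))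

  Joins-ι⁻ : ∀ {e x y} → Joins G (ιE e) (ιV x) (ιV y) → Joins H e x y
  Joins-ι⁻ {e} (inj₁ (s , t)) = inj₁ (ιV-inj (trans (sym (ιE-src e)) s) , ιV-inj (trans (sym (ιE-tgt e)) t))
  Joins-ι⁻ {e} (inj₂ (s , t)) = inj₂ (ιV-inj (trans (sym (ιE-src e)) s) , ιV-inj (trans (sym (ιE-tgt e)) t))

  edge-between-images : ∀ {f x y} → src G f ≡ ιV x → tgt G f ≡ ιV y → ∃ λ e → ιE e ≡ f
  edge-between-images {f} {x} {y} s t = ιE-onto f
    (λ eq → proj₁ (ιV-avoid x) (trans (sym s) eq)) (λ eq → proj₂ (ιV-avoid x) (trans (sym s) eq))
    (λ eq → proj₁ (ιV-avoid y) (trans (sym t) eq)) (λ eq → proj₂ (ιV-avoid y) (trans (sym t) eq))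

  Joins-images⇒preimage : ∀ {f x y} → Joins G f (ιV x) (ιV y) → ∃ λ e → ιE e ≡ f
  Joins-images⇒preimage (inj₁ (s , t)) = edge-between-images s t
  Joins-images⇒preimage (inj₂ (s , t)) = edge-between-images s t

  lift-Joins : ∀ {f x y} → Joins G f (ιV x) (ιV y) → ∃ λ e → Joins H e x y
  lift-Joins j with Joins-images⇒preimage j
  ... | e , refl = e , Joins-ι⁻ j

  isLoopedSimple : IsLoopedSimple G → IsLoopedSimple H
  isLoopedSimple LS = record
    { noSelfEdge = λ e eq → noSelfEdge (ιE e) (trans (ιE-src e) (trans (cong ιV eq) (sym (ιE-tgt e))))
    ; noMultiEdge = λ e f j → ιE-inj (noMultiEdge (ιE e) (ιE f)
        (subst₂ (Joins G (ιE f)) (sym (ιE-src e)) (sym (ιE-tgt e)) (Joins-ι j)))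
    }
    where open IsLoopedSimple LS

  isSymmetric : IsSymmetric G a → IsSymmetric H b
  isSymmetric SY = record
    { invV = invV-H
    ; invL = λ l → ιL-inj (begin
        ιL (σL b (σL b l)) ≡⟨ ιL-equiv (σL b l) ⟩
        σL a (ιL (σL b l)) ≡⟨ cong (σL a) (ιL-equiv l) ⟩
        σL a (σL a (ιL l)) ≡⟨ invL (ιL l) ⟩
        ιL l               ∎)
    ; adj = λ u w → mk⇔ (adj-H u w) (λ adjσ → subst₂ (Adjacent H) (invV-H u) (invV-H w) (adj-H _ _ adjσ))
    ; incid = λ l → ιV-inj (begin
        ιV (at H (σL b l))   ≡⟨ ιL-at (σL b l) ⟨
        at G (ιL (σL b l))   ≡⟨ cong (at G) (ιL-equiv l) ⟩
        at G (σL a (ιL l))   ≡⟨ incid (ιL l) ⟩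
        σV a (at G (ιL l))   ≡⟨ cong (σV a) (ιL-at l) ⟩
        σV a (ιV (at H l))   ≡⟨ ιV-equiv (at H l) ⟨
        ιV (σV b (at H l))   ∎)
    }
    where
    open IsSymmetric SY
    open ≡-Reasoning

    invV-H : ∀ u → σV b (σV b u) ≡ u
    invV-H u = ιV-inj (begin
      ιV (σV b (σV b u)) ≡⟨ ιV-equiv (σV b u) ⟩
      σV a (ιV (σV b u)) ≡⟨ cong (σV a) (ιV-equiv u) ⟩
      σV a (σV a (ιV u)) ≡⟨ invV (ιV u) ⟩
      ιV u               ∎)

    adj-H : ∀ u w → Adjacent H u w → Adjacent H (σV b u) (σV b w)
    adj-H u w (e , j) = lift-Joins
      (subst₂ (Joins G _) (sym (ιV-equiv u)) (sym (ιV-equiv w)) (proj₂ (adj (ιV u) (ιV w) .Equivalence.to (ιE e , Joins-ι j))))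

  image-subgraph : ∀ {V' E' L'} → IsSubgraph H V' E' L' → IsSubgraph G (image ιV V') (image ιE E') (image ιL L')
  image-subgraph {V'} {E'} {L'} (E'⊆ , L'⊆) = image-E⊆ , image-L⊆
    where
    image-E⊆ : ∀ f → f ∈ image ιE E' → src G f ∈ image ιV V' × tgt G f ∈ image ιV V'
    image-E⊆ f f∈ with ∈-image⁻ ιE f∈
    ... | e , e∈ , refl = subst (_∈ image ιV V') (sym (ιE-src e)) (∈-image⁺ ιV (proj₁ (E'⊆ e e∈)))
                        , subst (_∈ image ιV V') (sym (ιE-tgt e)) (∈-image⁺ ιV (proj₂ (E'⊆ e e∈)))
    image-L⊆ : ∀ m → m ∈ image ιL L' → at G m ∈ image ιV V'
    image-L⊆ m m∈ with ∈-image⁻ ιL m∈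
    ... | l , l∈ , refl = subst (_∈ image ιV V') (sym (ιL-at l)) (∈-image⁺ ιV (L'⊆ l l∈))

  sparse : Sparse G → Sparse H
  sparse sparseG V' E' L' sub
    with sparseG (image ιV V') (image ιE E') (image ιL L') (image-subgraph sub)
  ... | bound , loopless-bound
    rewrite ∣image∣≡∣p∣ ιV-inj V' | ∣image∣≡∣p∣ ιE-inj E' | ∣image∣≡∣p∣ ιL-inj L' = bound , loopless-bound

  edges-covered : nE G ≤ nE H + ∣ edgesAt G v ∪ edgesAt G (σV a v) ∣
  edges-covered = begin
    nE G                                         ≡⟨ ∣⊤∣≡n (nE G) ⟨
    ∣ ⊤ {nE G} ∣                                 ≤⟨ p⊆q⇒∣p∣≤∣q∣ {p = ⊤} (λ {f} _ → covered f) ⟩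
    ∣ image ιE ⊤ ∪ lost ∣                        ≤⟨ ∣p∪q∣≤∣p∣+∣q∣ (image ιE ⊤) lost ⟩
    ∣ image ιE ⊤ ∣ + ∣ lost ∣                    ≡⟨ cong (_+ ∣ lost ∣) (trans (∣image∣≡∣p∣ ιE-inj ⊤) (∣⊤∣≡n (nE H))) ⟩
    nE H + ∣ lost ∣                              ∎
    where
    open ≤-Reasoning
    lost : Subset (nE G)
    lost = edgesAt G v ∪ edgesAt G (σV a v)
    lost-at : ∀ x {f} → src G f ≡ x ⊎ tgt G f ≡ x → f ∈ edgesAt G x
    lost-at x = ∈-fromDec⁺ (incidentEdge? G x)
    covered : ∀ f → f ∈ image ιE ⊤ ∪ lost
    covered f with src G f ≟ v | src G f ≟ σV a v | tgt G f ≟ v | tgt G f ≟ σV a v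
    ... | yes s | _     | _     | _     = x∈p∪q⁺ (inj₂ (x∈p∪q⁺ (inj₁ (lost-at v (inj₁ s)))))
    ... | no _  | yes s | _     | _     = x∈p∪q⁺ (inj₂ (x∈p∪q⁺ (inj₂ (lost-at (σV a v) (inj₁ s)))))
    ... | no _  | no _  | yes t | _     = x∈p∪q⁺ (inj₂ (x∈p∪q⁺ (inj₁ (lost-at v (inj₂ t)))))
    ... | no _  | no _  | no _  | yes t = x∈p∪q⁺ (inj₂ (x∈p∪q⁺ (inj₂ (lost-at (σV a v) (inj₂ t)))))
    ... | no s  | no s' | no t  | no t' with ιE-onto f s s' t t'
    ...   | e , refl = x∈p∪q⁺ (inj₁ (∈-image⁺ ιE ∈⊤))

  loops-covered : nL G ≤ nL H + ∣ loopsAt G v ∪ loopsAt G (σV a v) ∣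
  loops-covered = begin
    nL G                                         ≡⟨ ∣⊤∣≡n (nL G) ⟨
    ∣ ⊤ {nL G} ∣                                 ≤⟨ p⊆q⇒∣p∣≤∣q∣ {p = ⊤} (λ {m} _ → covered m) ⟩
    ∣ image ιL ⊤ ∪ lost ∣                        ≤⟨ ∣p∪q∣≤∣p∣+∣q∣ (image ιL ⊤) lost ⟩
    ∣ image ιL ⊤ ∣ + ∣ lost ∣                    ≡⟨ cong (_+ ∣ lost ∣) (trans (∣image∣≡∣p∣ ιL-inj ⊤) (∣⊤∣≡n (nL H))) ⟩
    nL H + ∣ lost ∣                              ∎
    where
    open ≤-Reasoning
    lost : Subset (nL G)
    lost = loopsAt G v ∪ loopsAt G (σV a v)
    covered : ∀ m → m ∈ image ιL ⊤ ∪ lost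
    covered m with at G m ≟ v | at G m ≟ σV a v
    ... | yes s | _     = x∈p∪q⁺ (inj₂ (x∈p∪q⁺ (inj₁ (∈-fromDec⁺ (incidentLoop? G v) s))))
    ... | no _  | yes s = x∈p∪q⁺ (inj₂ (x∈p∪q⁺ (inj₂ (∈-fromDec⁺ (incidentLoop? G (σV a v)) s))))
    ... | no s  | no s' with ιL-onto m s s'
    ...   | l , refl = x∈p∪q⁺ (inj₁ (∈-image⁺ ιL ∈⊤))

  vertices-lost₁ : 1 + nV H ≤ nV G
  vertices-lost₁ = begin
    1 + nV H       ≡⟨ cong (1 +_) (∣⊤∣≡n (nV H)) ⟨
    1 + ∣ ⊤ {nV H} ∣ ≤⟨ s≤s (injection⇒∣p∣≤∣q∣ {p = ⊤} {q = ⊤ {nV G} - v} (λ {u} _ → ιV u)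
                         (λ {u} _ → x∈p∧x≢y⇒x∈p-y ∈⊤ (proj₁ (ιV-avoid u))) (λ _ _ → ιV-inj)) ⟩
    1 + ∣ ⊤ {nV G} - v ∣ ≤⟨ x∈p⇒∣p-x∣<∣p∣ {p = ⊤ {nV G}} ∈⊤ ⟩
    ∣ ⊤ {nV G} ∣   ≡⟨ ∣⊤∣≡n (nV G) ⟩
    nV G           ∎
    where open ≤-Reasoning

  vertices-lost₂ : v ≢ σV a v → 2 + nV H ≤ nV G
  vertices-lost₂ moved = begin
    2 + nV H                   ≡⟨ cong (2 +_) (∣⊤∣≡n (nV H)) ⟨
    2 + ∣ ⊤ {nV H} ∣           ≤⟨ s≤s (s≤s (injection⇒∣p∣≤∣q∣ {p = ⊤} {q = ⊤ {nV G} - v - σV a v} (λ {u} _ → ιV u)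
                                   (λ {u} _ → x∈p∧x≢y⇒x∈p-y (x∈p∧x≢y⇒x∈p-y ∈⊤ (proj₁ (ιV-avoid u))) (proj₂ (ιV-avoid u)))
                                   (λ _ _ → ιV-inj))) ⟩
    2 + ∣ ⊤ - v - σV a v ∣     ≤⟨ s≤s (x∈p⇒∣p-x∣<∣p∣ {p = ⊤ {nV G} - v} (x∈p∧x≢y⇒x∈p-y ∈⊤ (moved ∘ sym))) ⟩
    1 + ∣ ⊤ {nV G} - v ∣       ≤⟨ x∈p⇒∣p-x∣<∣p∣ {p = ⊤ {nV G}} ∈⊤ ⟩
    ∣ ⊤ {nV G} ∣               ≡⟨ ∣⊤∣≡n (nV G) ⟩
    nV G                       ∎
    where open ≤-Reasoning

  lostIncidences : ℕ
  lostIncidences = ∣ edgesAt G v ∪ edgesAt G (σV a v) ∣ + ∣ loopsAt G v ∪ loopsAt G (σV a v) ∣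

  size-covered : nE G + nL G ≤ (nE H + nL H) + lostIncidences
  size-covered = ≤-trans (+-mono-≤ edges-covered loops-covered)
    (≤-reflexive (interchange (nE H) _ (nL H) _))

  lostIncidences≤ : lostIncidences ≤ incidence G v + incidence G (σV a v)
  lostIncidences≤ = begin
    lostIncidences
      ≤⟨ +-mono-≤ (∣p∪q∣≤∣p∣+∣q∣ (edgesAt G v) _) (∣p∪q∣≤∣p∣+∣q∣ (loopsAt G v) _) ⟩
    (∣ edgesAt G v ∣ + ∣ edgesAt G (σV a v) ∣) + (∣ loopsAt G v ∣ + ∣ loopsAt G (σV a v) ∣)
      ≡⟨ interchange (∣ edgesAt G v ∣) (∣ edgesAt G (σV a v) ∣) (∣ loopsAt G v ∣) (∣ loopsAt G (σV a v) ∣) ⟩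
    (∣ edgesAt G v ∣ + ∣ loopsAt G v ∣) + (∣ edgesAt G (σV a v) ∣ + ∣ loopsAt G (σV a v) ∣)
      ≡⟨ cong₂ _+_ (incidence≡∣edgesAt∣+∣loopsAt∣ G v) (incidence≡∣edgesAt∣+∣loopsAt∣ G (σV a v)) ⟨
    incidence G v + incidence G (σV a v) ∎
    where open ≤-Reasoning

  lostIncidences-fixed : FixedV G a v → lostIncidences ≡ incidence G v
  lostIncidences-fixed fixed rewrite fixed
    | ∪-idem (edgesAt G v) | ∪-idem (loopsAt G v) = sym (incidence≡∣edgesAt∣+∣loopsAt∣ G v)

  lost-bound : IsLoopedSimple G → IsSymmetric G a → incidence G v ≡ 2
    → ∃ λ k → k + nV H ≤ nV G × lostIncidences ≤ 2 * k
  lost-bound LS SY inc with v ≟ σV a v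
  ... | yes v≡σv = 1 , vertices-lost₁ , ≤-reflexive (trans (lostIncidences-fixed (sym v≡σv)) inc)
  ... | no v≢σv = 2 , vertices-lost₂ v≢σv , (begin
    lostIncidences                            ≤⟨ lostIncidences≤ ⟩
    incidence G v + incidence G (σV a v)      ≤⟨ +-monoʳ-≤ (incidence G v) (incidence-σV LS (σV a v)) ⟩
    incidence G v + incidence G (σV a (σV a v)) ≡⟨ cong₂ _+_ inc (trans (cong (incidence G) (invV v)) inc) ⟩
    2 * 2                                     ∎)
    where
    open ≤-Reasoning
    open IsSymmetric SY
    open Symmetric SY

  tight : IsLoopedSimple G → IsSymmetric G a → Tight G → incidence G v ≡ 2 → Tight H
  tight LS SY (sparseG , sizeG) inc with lost-bound LS SY inc
  ... | k , verticesᵏ , lostᵏ = sparseH , ≤-antisym (Sparse⇒size≤ H sparseH) (+-cancelˡ-≤ (2 * k) _ _ (begin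
    2 * k + 2 * nV H         ≡⟨ *-distribˡ-+ 2 k (nV H) ⟨
    2 * (k + nV H)           ≤⟨ *-monoʳ-≤ 2 verticesᵏ ⟩
    2 * nV G                 ≡⟨ sizeG ⟨
    nE G + nL G              ≤⟨ size-covered ⟩
    (nE H + nL H) + lostIncidences ≤⟨ +-monoʳ-≤ (nE H + nL H) lostᵏ ⟩
    (nE H + nL H) + 2 * k    ≡⟨ +-comm (nE H + nL H) (2 * k) ⟩
    2 * k + (nE H + nL H)    ∎))
    where
    open ≤-Reasoning
    sparseH : Sparse H
    sparseH = sparse sparseG

  fixedV⇔ : ∀ u → FixedV H b u ⇔ FixedV G a (ιV u)
  fixedV⇔ u = mk⇔ (λ fixed → trans (sym (ιV-equiv u)) (cong ιV fixed))
                  (λ fixed → ιV-inj (trans (ιV-equiv u) fixed))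

  fixedL⇔ : ∀ l → FixedL H b l ⇔ FixedL G a (ιL l)
  fixedL⇔ l = mk⇔ (λ fixed → trans (sym (ιL-equiv l)) (cong ιL fixed))
                  (λ fixed → ιL-inj (trans (ιL-equiv l) fixed))

  fixedE⇒ : ∀ e → FixedE H b e → FixedE G a (ιE e)
  fixedE⇒ e fixed = subst₂ (Joins G (ιE e))
    (trans (ιV-equiv (src H e)) (cong (σV a) (sym (ιE-src e))))
    (trans (ιV-equiv (tgt H e)) (cong (σV a) (sym (ιE-tgt e))))
    (Joins-ι fixed)

  no-fixed-edge : (∀ f → ¬ FixedE G a f) → ∀ e → ¬ FixedE H b e
  no-fixed-edge none e = none (ιE e) ∘ fixedE⇒ e

  c2Fixed : IsSymmetric G a → C2Fixed G a → C2Fixed H b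
  c2Fixed SY (inj₁ (noV , noE , noL)) = inj₁
    ( (λ u → noV (ιV u) ∘ fixedV⇔ u .Equivalence.to)
    , no-fixed-edge noE
    , (λ l → noL (ιL l) ∘ fixedL⇔ l .Equivalence.to))
  c2Fixed SY (inj₂ (oneV@(w , _ , onlyw) , twoL , noE)) with v ≟ σV a v
  ... | yes v≡σv = inj₁
    ( (λ u fixed → proj₁ (ιV-avoid u) (fixed≡v (fixedV⇔ u .Equivalence.to fixed)))
    , no-fixed-edge noE
    , (λ l fixed → proj₁ (ιV-avoid (at H l)) (trans (sym (ιL-at l))
        (fixed≡v (fixed-loop⇒fixed-vertex (fixedL⇔ l .Equivalence.to fixed))))))
    where
    open Symmetric SY
    fixed≡v : ∀ {x} → FixedV G a x → x ≡ v
    fixed≡v fixed = trans (onlyw _ fixed) (sym (onlyw v (sym v≡σv)))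
  ... | no v≢σv = inj₂
    ( ExactlyOne-pullback ιV-inj fixedV⇔ (λ fixed → uncurry (ιV-onto _) (avoids fixed)) oneV
    , ExactlyTwo-pullback ιL-inj fixedL⇔ (λ fixed → uncurry (ιL-onto _) (avoids (fixed-loop⇒fixed-vertex fixed))) twoL
    , no-fixed-edge noE)
    where
    open Symmetric SY
    avoids : ∀ {x} → FixedV G a x → x ≢ v × x ≢ σV a v
    avoids fixed = fixed-vertex-avoids-orbit fixed (v≢σv ∘ sym)

  c2Tight : IsLoopedSimple G → IsSymmetric G a → C2Tight G a → incidence G v ≡ 2 → C2Tight H b
  c2Tight LS SY (tightG , fixedG) inc = tight LS SY tightG inc , c2Fixed SY fixedG

lemma5p2 : (G : Graph) (a : Action G) → IsLoopedSimple G → IsSymmetric G a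
    → C2Tight G a → (v : Fin (nV G)) → incidence G v ≡ 2
    → (H : Graph) (b : Action H) → IsDeletion G a v H b
    → IsLoopedSimple H × IsSymmetric H b × C2Tight H b
lemma5p2 G a LS SY c2 v inc H b D = isLoopedSimple LS , isSymmetric SY , c2Tight LS SY c2 inc
  where open Deletion D
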